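{- Let $X$ be a strongly regular graph with parameters $(n,k,a,c)$ (as defined in the context), whose eigenvalues $\lambda_1>\lambda_2$ other than $k$ are integers, and let $e=\lambda_1$. Let $$D=e(e+1)(e-a)(e-a-1),\qquad F=(e+1)(e^2+2e-a)(e^2+3e-a).$$ Then $D$ is an integer multiple of $c$ and $F$ is an integer multiple of $c+2e-a$.
   Context: A graph $X$ is a strongly regular graph with parameters $(n,k,a,c)$ if it is a connected, non-bipartite graph on $n$ vertices which is regular of degree $k$, any two adjacent vertices have exactly $a$ common neighbours, any two distinct non-adjacent vertices have exactly $c$ common neighbours, and $k\ge 3$, $k>c\ge 1$. Its adjacency matrix has eigenvalue $k$ (multiplicity 1) and the two roots $\lambda_1>\lambda_2$ of $\lambda^2-(a-c)\lambda-(k-c)=0$. -}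

module Defs where

open import Data.Nat using (ℕ; zero; suc; _≤_; _<_)
open import Data.Fin using (Fin)
open import Data.Bool using (Bool; true; false; _∧_; T)
open import Data.List using (List; length; filterᵇ; allFin)
open import Data.Product using (Σ; _×_; _,_)
open import Relation.Binary.PropositionalEquality using (_≡_; _≢_)
open import Relation.Nullary using (¬_)

record Graph (n : ℕ) : Set where
  field
    adj       : Fin n → Fin n → Bool
    symmetric : ∀ u v → adj u v ≡ adj v u
    loopless  : ∀ u → adj u u ≡ false
open Graph public

card : ∀ {n} → (Fin n → Bool) → ℕ
card {n} p = length (filterᵇ p (allFin n))

Adj : ∀ {n} → Graph n → Fin n → Fin n → Set
Adj G u v = T (adj G u v)

degree : ∀ {n} → Graph n → Fin n → ℕ
degree G u = card (adj G u)

commonNeighbours : ∀ {n} → Graph n → Fin n → Fin n → ℕ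
commonNeighbours G u v = card (λ w → adj G u w ∧ adj G w v)

data Reachable {n} (G : Graph n) : Fin n → Fin n → Set where
  here : ∀ {u} → Reachable G u u
  step : ∀ {u v w} → Adj G u v → Reachable G v w → Reachable G u w

Connected : ∀ {n} → Graph n → Set
Connected G = ∀ u v → Reachable G u v

Bipartite : ∀ {n} → Graph n → Set
Bipartite {n} G = Σ (Fin n → Bool) λ col → ∀ u v → Adj G u v → col u ≢ col v

record IsSRG {n} (G : Graph n) (k a c : ℕ) : Set where
  field
    connected    : Connected G
    nonBipartite : ¬ Bipartite G
    regular      : ∀ u → degree G u ≡ k
    adjCommon    : ∀ u v → Adj G u v → commonNeighbours G u v ≡ a
    nonAdjCommon : ∀ u v → u ≢ v → ¬ Adj G u v → commonNeighbours G u v ≡ c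
    k≥3          : 3 ≤ k
    c<k          : c < k
    c≥1          : 1 ≤ c

-- The adjacency matrix A satisfies A² = (k − c)I + (a − c)A + cJ. Summing a row gives
-- k² = (k − c) + (a − c)k + nc, i.e. nc = (k − e)(k − f) for the other root f = a − c − e,
-- and modulo c this already yields c ∣ D. For F, the matrix Q = n(A − fI) − (k − f)J satisfies
-- Q² = n(e − f)Q, and the trace of an integer matrix with Q² = NQ is divisible by N (it is N
-- times the rank of Q/N; proved by rank-one deflation and induction on the size). Since
-- trace Q = −n((n − 1)f + k), the multiplicity −((n − 1)f + k)/(e − f) of e is an integer, and
-- reducing F modulo e − f = c + 2e − a, where f ≡ e, gives the second divisibility.

module Submission where

open import Defs
open import Data.Nat using (ℕ; zero; suc)
open import Data.Fin using (Fin; zero; suc; punchIn)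
open import Data.Fin.Properties using (_≟_; punchInᵢ≢i; all?; ¬∀⟶∃¬; nonZeroIndex)
open import Data.Bool using (Bool; true; false; _∧_; T)
open import Data.Bool.Properties using (∧-idem)
open import Data.List using (length; filterᵇ; tabulate)
open import Data.Unit using (tt)
open import Data.Empty using (⊥-elim)
open import Data.Product using (_×_; _,_; ∃₂)
open import Data.Sum using (_⊎_; inj₁; inj₂)
open import Data.Integer using (ℤ; +_; _+_; _-_; _*_; -_; _<_; 0ℤ; 1ℤ; -1ℤ; ≢-nonZero)
import Data.Integer.Properties as ℤ
open import Data.Integer.Divisibility using (_∣_)
open import Data.Integer.Divisibility.Signed
  using (divides; ∣-refl; ∣m∣n⇒∣m+n; ∣n⇒∣m*n; ∣m⇒∣-m; *-cancelˡ-∣; ∣⇒∣ᵤ) renaming (_∣_ to _∣ˢ_)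
open import Data.Integer.Tactic.RingSolver using (solve-∀)
open import Relation.Nullary using (yes; no)
open import Relation.Nullary.Decidable using (does; dec-true; dec-false)
open import Relation.Binary.PropositionalEquality
open import Algebra.Properties.Semiring.Sum ℤ.+-*-semiring
  using (sum; sum-syntax; sum-cong-≗; sum-remove; sum-replicate-zero; ∑-distrib-+; ∑-comm;
         *-distribˡ-sum; *-distribʳ-sum)

open ≡-Reasoning

𝟙 : Bool → ℤ
𝟙 true  = 1ℤ
𝟙 false = 0ℤ

∑-const : ∀ n (x : ℤ) → ∑[ i < n ] x ≡ + n * x
∑-const zero    x = refl
∑-const (suc n) x = trans (cong (_+_ x) (∑-const n x)) (factor (+ n) x)
  where
  factor : ∀ m x → x + m * x ≡ (1ℤ + m) * x
  factor = solve-∀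

sum-single : ∀ {n} (g : Fin n → ℤ) (i : Fin n) → (∀ j → j ≢ i → g j ≡ 0ℤ) → sum g ≡ g i
sum-single {suc n} g i vanish = begin
  sum g                                 ≡⟨ sum-remove {i = i} g ⟩
  g i + ∑[ j < n ] g (punchIn i j)      ≡⟨ cong (_+_ (g i)) (sum-cong-≗ (λ j → vanish _ (punchInᵢ≢i i j))) ⟩
  g i + ∑[ j < n ] 0ℤ                   ≡⟨ cong (_+_ (g i)) (sum-replicate-zero n) ⟩
  g i + 0ℤ                              ≡⟨ ℤ.+-identityʳ (g i) ⟩
  g i                                   ∎

δ : ∀ {n} → Fin n → Fin n → ℤ
δ i j = 𝟙 (does (i ≟ j))

δ-diag : ∀ {n} (i : Fin n) → δ i i ≡ 1ℤ
δ-diag i = cong 𝟙 (dec-true (i ≟ i) refl)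

δ-offdiag : ∀ {n} {i j : Fin n} → i ≢ j → δ i j ≡ 0ℤ
δ-offdiag {i = i} {j} i≢j = cong 𝟙 (dec-false (i ≟ j) i≢j)

∑-δˡ : ∀ {n} (i : Fin n) (g : Fin n → ℤ) → ∑[ j < n ] (δ i j * g j) ≡ g i
∑-δˡ i g = trans (sum-single _ i (λ j j≢i → cong (_* g j) (δ-offdiag (≢-sym j≢i))))
                 (trans (cong (_* g i) (δ-diag i)) (ℤ.*-identityˡ (g i)))

∑-δʳ : ∀ {n} (i : Fin n) (g : Fin n → ℤ) → ∑[ j < n ] (g j * δ j i) ≡ g i
∑-δʳ i g = trans (sum-single _ i (λ j j≢i → trans (cong (g j *_) (δ-offdiag j≢i)) (ℤ.*-zeroʳ (g j))))
                 (trans (cong (g i *_) (δ-diag i)) (ℤ.*-identityʳ (g i)))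

∑-δ : ∀ {n} (x : Fin n) → ∑[ z < n ] δ x z ≡ 1ℤ
∑-δ x = trans (sum-single (δ x) x (λ z z≢x → δ-offdiag (≢-sym z≢x))) (δ-diag x)

∑-lincomb : ∀ {n} (α β : ℤ) (u v : Fin n → ℤ) →
            ∑[ i < n ] (α * u i + β * v i) ≡ α * sum u + β * sum v
∑-lincomb α β u v = trans (∑-distrib-+ (λ i → α * u i) (λ i → β * v i))
  (sym (cong₂ _+_ (*-distribˡ-sum α u) (*-distribˡ-sum β v)))

∑-bilinear : ∀ {n} (α β γ ε : ℤ) (u u′ w w′ : Fin n → ℤ) →
             ∑[ i < n ] ((α * u i + β * u′ i) * (γ * w i + ε * w′ i)) ≡
             (α * γ * ∑[ i < n ] (u i * w i) + α * ε * ∑[ i < n ] (u i * w′ i)) +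
             (β * γ * ∑[ i < n ] (u′ i * w i) + β * ε * ∑[ i < n ] (u′ i * w′ i))
∑-bilinear α β γ ε u u′ w w′ =
  trans (sum-cong-≗ (λ i → expand α β γ ε (u i) (u′ i) (w i) (w′ i)))
  (trans (∑-distrib-+ (λ i → α * γ * (u i * w i) + α * ε * (u i * w′ i))
                      (λ i → β * γ * (u′ i * w i) + β * ε * (u′ i * w′ i)))
         (cong₂ _+_ (∑-lincomb (α * γ) (α * ε) (λ i → u i * w i) (λ i → u i * w′ i))
                    (∑-lincomb (β * γ) (β * ε) (λ i → u′ i * w i) (λ i → u′ i * w′ i))))
  where
  expand : ∀ α β γ ε u u′ w w′ →
           (α * u + β * u′) * (γ * w + ε * w′) ≡
           (α * γ * (u * w) + α * ε * (u * w′)) + (β * γ * (u′ * w) + β * ε * (u′ * w′))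
  expand = solve-∀

-- Integer matrices with Q² = N Q

Mat : ℕ → Set
Mat n = Fin n → Fin n → ℤ

square : ∀ {n} → Mat n → Mat n
square {n} M x z = ∑[ y < n ] (M x y * M y z)

trace : ∀ {n} → Mat n → ℤ
trace {n} M = ∑[ x < n ] M x x

minor : ∀ {n} → Fin (suc n) → Mat (suc n) → Mat n
minor i M a b = M (punchIn i a) (punchIn i b)

square-minor : ∀ {n} (i : Fin (suc n)) (M : Mat (suc n)) → (∀ y → M i y ≡ 0ℤ) →
               ∀ a b → square (minor i M) a b ≡ square M (punchIn i a) (punchIn i b)
square-minor i M row-i≡0 a b = sym (begin
  square M (punchIn i a) (punchIn i b)
    ≡⟨ sum-remove {i = i} (λ y → M (punchIn i a) y * M y (punchIn i b)) ⟩
  M (punchIn i a) i * M i (punchIn i b) + square (minor i M) a b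
    ≡⟨ cong (λ t → M (punchIn i a) i * t + square (minor i M) a b) (row-i≡0 (punchIn i b)) ⟩
  M (punchIn i a) i * 0ℤ + square (minor i M) a b
    ≡⟨ cong (_+ square (minor i M) a b) (ℤ.*-zeroʳ (M (punchIn i a) i)) ⟩
  0ℤ + square (minor i M) a b                                 ≡⟨ ℤ.+-identityˡ _ ⟩
  square (minor i M) a b                                      ∎)

trace-minor : ∀ {n} (i : Fin (suc n)) (M : Mat (suc n)) → M i i ≡ 0ℤ → trace M ≡ trace (minor i M)
trace-minor i M M[i,i]≡0 = begin
  trace M                         ≡⟨ sum-remove {i = i} (λ x → M x x) ⟩
  M i i + trace (minor i M)       ≡⟨ cong (_+ trace (minor i M)) M[i,i]≡0 ⟩
  0ℤ + trace (minor i M)          ≡⟨ ℤ.+-identityˡ _ ⟩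
  trace (minor i M)               ∎

QuasiIdempotent : ∀ {n} → ℤ → Mat n → Set
QuasiIdempotent N Q = ∀ x z → square Q x z ≡ N * Q x z

-- Over a field this is Q i j · N times the rank-one deflation of the idempotent Q / N: its rank
-- is one less, and its row i vanishes.
deflate : ∀ {n} → Fin n → Fin n → Mat n → Mat n
deflate i j Q x y = Q i j * Q x y - Q x j * Q i y

deflate-row≡0 : ∀ {n} (i j : Fin n) (Q : Mat n) → ∀ y → deflate i j Q i y ≡ 0ℤ
deflate-row≡0 i j Q y = ℤ.+-inverseʳ (Q i j * Q i y)

module _ {n} {N : ℤ} {Q : Mat n} (Q²≡NQ : QuasiIdempotent N Q) (i j : Fin n) where

  private
    p : ℤ
    p = Q i j

  square-deflate : QuasiIdempotent (p * N) (deflate i j Q)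
  square-deflate x z = begin
    square (deflate i j Q) x z
      ≡⟨ sum-cong-≗ (λ y → split p (Q x y) (Q x j) (Q i y) (Q y z) (Q y j) (Q i z)) ⟩
    ∑[ y < n ] ((p * Q x y + - Q x j * Q i y) * (p * Q y z + - Q i z * Q y j))
      ≡⟨ ∑-bilinear p (- Q x j) p (- Q i z) (Q x) (Q i) (λ y → Q y z) (λ y → Q y j) ⟩
    (p * p * square Q x z + p * - Q i z * square Q x j) +
    (- Q x j * p * square Q i z + - Q x j * - Q i z * square Q i j)
      ≡⟨ cong₂ _+_ (cong₂ _+_ (cong (p * p *_) (Q²≡NQ x z)) (cong (p * - Q i z *_) (Q²≡NQ x j)))
                   (cong₂ _+_ (cong (- Q x j * p *_) (Q²≡NQ i z)) (cong (- Q x j * - Q i z *_) (Q²≡NQ i j))) ⟩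
    (p * p * (N * Q x z) + p * - Q i z * (N * Q x j)) +
    (- Q x j * p * (N * Q i z) + - Q x j * - Q i z * (N * p))
      ≡⟨ collect p N (Q x z) (Q x j) (Q i z) ⟩
    p * N * deflate i j Q x z ∎
    where
    split : ∀ p a b c d e g → (p * a - b * c) * (p * d - e * g) ≡ (p * a + - b * c) * (p * d + - g * e)
    split = solve-∀
    collect : ∀ p N a b c →
              (p * p * (N * a) + p * - c * (N * b)) + (- b * p * (N * c) + - b * - c * (N * p)) ≡
              p * N * (p * a - b * c)
    collect = solve-∀

  trace-deflate : trace (deflate i j Q) ≡ p * (trace Q - N)
  trace-deflate = begin
    trace (deflate i j Q)
      ≡⟨ sum-cong-≗ (λ x → split p (Q x x) (Q x j) (Q i x)) ⟩
    ∑[ x < n ] (p * Q x x + -1ℤ * (Q i x * Q x j))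
      ≡⟨ ∑-lincomb p -1ℤ (λ x → Q x x) (λ x → Q i x * Q x j) ⟩
    p * trace Q + -1ℤ * square Q i j
      ≡⟨ cong (λ t → p * trace Q + -1ℤ * t) (Q²≡NQ i j) ⟩
    p * trace Q + -1ℤ * (N * p)
      ≡⟨ collect p N (trace Q) ⟩
    p * (trace Q - N) ∎
    where
    split : ∀ p a b c → p * a - b * c ≡ p * a + -1ℤ * (c * b)
    split = solve-∀
    collect : ∀ p N t → p * t + -1ℤ * (N * p) ≡ p * (t - N)
    collect = solve-∀

nonzero-entry? : ∀ {n} (Q : Mat n) → (∀ x y → Q x y ≡ 0ℤ) ⊎ ∃₂ (λ x y → Q x y ≢ 0ℤ)
nonzero-entry? {n} Q with all? (λ x → all? (λ y → Q x y ℤ.≟ 0ℤ))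
... | yes Q≡0 = inj₁ Q≡0
... | no Q≢0 with ¬∀⟶∃¬ n _ (λ x → all? (λ y → Q x y ℤ.≟ 0ℤ)) Q≢0
...   | x , row≢0 with ¬∀⟶∃¬ n _ (λ y → Q x y ℤ.≟ 0ℤ) row≢0
...     | y , Qxy≢0 = inj₂ (x , y , Qxy≢0)

trace-divisible : ∀ {n} (N : ℤ) (Q : Mat n) → QuasiIdempotent N Q → N ∣ˢ trace Q
trace-divisible {zero}  N Q _ = divides 0ℤ refl
trace-divisible {suc n} N Q Q²≡NQ with nonzero-entry? Q
... | inj₁ Q≡0 = subst (N ∣ˢ_) (sym trace≡0) (divides 0ℤ refl)
  where
  trace≡0 : trace Q ≡ 0ℤ
  trace≡0 = trans (sum-cong-≗ (λ x → Q≡0 x x)) (sum-replicate-zero (suc n))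
... | inj₂ (i , j , p≢0) = subst (N ∣ˢ_) (t-N+N≡t (trace Q) N) (∣m∣n⇒∣m+n N∣trQ-N ∣-refl)
  where
  D : Mat (suc n)
  D = deflate i j Q
  pN∣minor : Q i j * N ∣ˢ trace (minor i D)
  pN∣minor = trace-divisible (Q i j * N) (minor i D)
    (λ a b → trans (square-minor i D (deflate-row≡0 i j Q) a b) (square-deflate {N = N} {Q} Q²≡NQ i j _ _))
  pN∣p[trQ-N] : Q i j * N ∣ˢ Q i j * (trace Q - N)
  pN∣p[trQ-N] = subst (Q i j * N ∣ˢ_)
    (trans (sym (trace-minor i D (deflate-row≡0 i j Q i))) (trace-deflate {N = N} {Q} Q²≡NQ i j)) pN∣minor
  N∣trQ-N : N ∣ˢ trace Q - N
  N∣trQ-N = *-cancelˡ-∣ (Q i j) {{≢-nonZero p≢0}} pN∣p[trQ-N]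
  t-N+N≡t : ∀ t N → t - N + N ≡ t
  t-N+N≡t = solve-∀

RowSums : ∀ {n} → ℤ → Mat n → Set
RowSums {n} L M = ∀ x → ∑[ y < n ] M x y ≡ L

ColumnSums : ∀ {n} → ℤ → Mat n → Set
ColumnSums {n} L M = ∀ y → ∑[ x < n ] M x y ≡ L

-- Up to the factor n θ, n E − L J is the projection onto the θ-eigenspace of E.
quasiIdempotent-projection : ∀ {n} {θ C L : ℤ} (E : Mat n) →
  (∀ x z → square E x z ≡ θ * E x z + C) → RowSums L E → ColumnSums L E →
  + n * C ≡ L * (L - θ) → QuasiIdempotent (+ n * θ) (λ x y → + n * E x y - L)
quasiIdempotent-projection {n} {θ} {C} {L} E E²≡θE+C rows cols nC≡L[L-θ] x z = begin
  ∑[ y < n ] ((+ n * E x y - L) * (+ n * E y z - L))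
    ≡⟨ sum-cong-≗ (λ y → split (+ n) L (E x y) (E y z)) ⟩
  ∑[ y < n ] ((+ n * E x y + - L * 1ℤ) * (+ n * E y z + - L * 1ℤ))
    ≡⟨ ∑-bilinear (+ n) (- L) (+ n) (- L) (E x) (λ _ → 1ℤ) (λ y → E y z) (λ _ → 1ℤ) ⟩
  (+ n * + n * square E x z + + n * - L * ∑[ y < n ] (E x y * 1ℤ)) +
  (- L * + n * ∑[ y < n ] (1ℤ * E y z) + - L * - L * ∑[ y < n ] (1ℤ * 1ℤ))
    ≡⟨ cong₂ _+_ (cong₂ _+_ (cong (+ n * + n *_) (E²≡θE+C x z))
                            (cong (+ n * - L *_) (trans (sum-cong-≗ (λ y → ℤ.*-identityʳ (E x y))) (rows x))))
                 (cong₂ _+_ (cong (- L * + n *_) (trans (sum-cong-≗ (λ y → ℤ.*-identityˡ (E y z))) (cols z)))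
                            (cong (- L * - L *_) (∑-const n 1ℤ))) ⟩
  (+ n * + n * (θ * E x z + C) + + n * - L * L) + (- L * + n * L + - L * - L * (+ n * 1ℤ))
    ≡⟨ collect (+ n) θ C L (E x z) ⟩
  + n * θ * (+ n * E x z - L) + + n * (+ n * C - L * (L - θ))
    ≡⟨ cong (λ t → + n * θ * (+ n * E x z - L) + + n * t) (ℤ.i≡j⇒i-j≡0 nC≡L[L-θ]) ⟩
  + n * θ * (+ n * E x z - L) + + n * 0ℤ
    ≡⟨ drop (+ n * θ * (+ n * E x z - L)) (+ n) ⟩
  + n * θ * (+ n * E x z - L) ∎
  where
  split : ∀ n L a b → (n * a - L) * (n * b - L) ≡ (n * a + - L * 1ℤ) * (n * b + - L * 1ℤ)
  split = solve-∀
  collect : ∀ n θ C L e →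
    (n * n * (θ * e + C) + n * - L * L) + (- L * n * L + - L * - L * (n * 1ℤ)) ≡
    n * θ * (n * e - L) + n * (n * C - L * (L - θ))
  collect = solve-∀
  drop : ∀ a n → a + n * 0ℤ ≡ a
  drop = solve-∀

-- Matrices satisfying the strongly regular equation

SRGEquation : ∀ {n} → ℤ → ℤ → ℤ → Mat n → Set
SRGEquation K Ac C A = ∀ x z → square A x z ≡ (K - C) * δ x z + (Ac - C) * A x z + C

module _ {n} {K Ac C : ℤ} {A : Mat n} (rows : RowSums K A) (A²≡ : SRGEquation K Ac C A) where

  count-identity : Fin n → K * K ≡ (K - C) + (Ac - C) * K + + n * C
  count-identity x = begin
    K * K                                            ≡⟨ cong (_* K) (sym (rows x)) ⟩
    sum (A x) * K                                    ≡⟨ *-distribʳ-sum K (A x) ⟩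
    ∑[ y < n ] (A x y * K)                           ≡⟨ sum-cong-≗ (λ y → cong (A x y *_) (sym (rows y))) ⟩
    ∑[ y < n ] (A x y * sum (A y))                   ≡⟨ sum-cong-≗ (λ y → *-distribˡ-sum (A x y) (A y)) ⟩
    ∑[ y < n ] ∑[ z < n ] (A x y * A y z)            ≡⟨ ∑-comm (λ y z → A x y * A y z) ⟩
    ∑[ z < n ] square A x z                          ≡⟨ sum-cong-≗ (A²≡ x) ⟩
    ∑[ z < n ] ((K - C) * δ x z + (Ac - C) * A x z + C)
      ≡⟨ ∑-distrib-+ (λ z → (K - C) * δ x z + (Ac - C) * A x z) (λ _ → C) ⟩
    ∑[ z < n ] ((K - C) * δ x z + (Ac - C) * A x z) + ∑[ z < n ] C
      ≡⟨ cong₂ _+_ (∑-lincomb (K - C) (Ac - C) (δ x) (A x)) (∑-const n C) ⟩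
    (K - C) * sum (δ x) + (Ac - C) * sum (A x) + + n * C
      ≡⟨ cong₂ (λ s t → (K - C) * s + (Ac - C) * t + + n * C) (∑-δ x) (rows x) ⟩
    (K - C) * 1ℤ + (Ac - C) * K + + n * C
      ≡⟨ cong (λ t → t + (Ac - C) * K + + n * C) (ℤ.*-identityʳ (K - C)) ⟩
    (K - C) + (Ac - C) * K + + n * C ∎

module SRGMatrix {n} {K Ac C : ℤ} (A : Mat n) (rows : RowSums K A) (cols : ColumnSums K A)
                 (A²≡ : SRGEquation K Ac C A) {e f : ℤ} (e+f≡ : Ac - C ≡ e + f) (ef≡ : K - C ≡ - (e * f)) where

  shifted : Mat n
  shifted x y = A x y - f * δ x y

  square-shifted : ∀ x z → square shifted x z ≡ (e - f) * shifted x z + C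
  square-shifted x z = begin
    square shifted x z
      ≡⟨ sum-cong-≗ (λ y → split f (A x y) (δ x y) (A y z) (δ y z)) ⟩
    ∑[ y < n ] ((1ℤ * A x y + - f * δ x y) * (1ℤ * A y z + - f * δ y z))
      ≡⟨ ∑-bilinear 1ℤ (- f) 1ℤ (- f) (A x) (δ x) (λ y → A y z) (λ y → δ y z) ⟩
    (1ℤ * 1ℤ * square A x z + 1ℤ * - f * ∑[ y < n ] (A x y * δ y z)) +
    (- f * 1ℤ * ∑[ y < n ] (δ x y * A y z) + - f * - f * ∑[ y < n ] (δ x y * δ y z))
      ≡⟨ cong₂ _+_ (cong₂ _+_ (cong (1ℤ * 1ℤ *_) (A²≡ x z)) (cong (1ℤ * - f *_) (∑-δʳ z (A x))))
                   (cong₂ _+_ (cong (- f * 1ℤ *_) (∑-δˡ x (λ y → A y z))) (cong (- f * - f *_) (∑-δˡ x (λ y → δ y z)))) ⟩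
    (1ℤ * 1ℤ * ((K - C) * δ x z + (Ac - C) * A x z + C) + 1ℤ * - f * A x z) +
    (- f * 1ℤ * A x z + - f * - f * δ x z)
      ≡⟨ cong₂ (λ s t → (1ℤ * 1ℤ * (s * δ x z + t * A x z + C) + 1ℤ * - f * A x z) +
                        (- f * 1ℤ * A x z + - f * - f * δ x z)) ef≡ e+f≡ ⟩
    (1ℤ * 1ℤ * (- (e * f) * δ x z + (e + f) * A x z + C) + 1ℤ * - f * A x z) +
    (- f * 1ℤ * A x z + - f * - f * δ x z)
      ≡⟨ collect e f C (A x z) (δ x z) ⟩
    (e - f) * shifted x z + C ∎
    where
    split : ∀ f a d b d′ → (a - f * d) * (b - f * d′) ≡ (1ℤ * a + - f * d) * (1ℤ * b + - f * d′)
    split = solve-∀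
    collect : ∀ e f C a d →
      (1ℤ * 1ℤ * (- (e * f) * d + (e + f) * a + C) + 1ℤ * - f * a) + (- f * 1ℤ * a + - f * - f * d) ≡
      (e - f) * (a - f * d) + C
    collect = solve-∀

  rows-shifted : RowSums (K - f) shifted
  rows-shifted x = begin
    ∑[ y < n ] (A x y - f * δ x y)          ≡⟨ sum-cong-≗ (λ y → split f (A x y) (δ x y)) ⟩
    ∑[ y < n ] (1ℤ * A x y + - f * δ x y)   ≡⟨ ∑-lincomb 1ℤ (- f) (A x) (δ x) ⟩
    1ℤ * sum (A x) + - f * sum (δ x)        ≡⟨ cong₂ (λ s t → 1ℤ * s + - f * t) (rows x) (∑-δ x) ⟩
    1ℤ * K + - f * 1ℤ                       ≡⟨ collect K f ⟩
    K - f                                   ∎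
    where
    split : ∀ f a d → a - f * d ≡ 1ℤ * a + - f * d
    split = solve-∀
    collect : ∀ K f → 1ℤ * K + - f * 1ℤ ≡ K - f
    collect = solve-∀

  columns-shifted : ColumnSums (K - f) shifted
  columns-shifted y = begin
    ∑[ x < n ] (A x y - f * δ x y)                  ≡⟨ sum-cong-≗ (λ x → split f (A x y) (δ x y)) ⟩
    ∑[ x < n ] (1ℤ * A x y + - f * (1ℤ * δ x y))    ≡⟨ ∑-lincomb 1ℤ (- f) (λ x → A x y) (λ x → 1ℤ * δ x y) ⟩
    1ℤ * ∑[ x < n ] A x y + - f * ∑[ x < n ] (1ℤ * δ x y)
      ≡⟨ cong₂ (λ s t → 1ℤ * s + - f * t) (cols y) (∑-δʳ y (λ _ → 1ℤ)) ⟩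
    1ℤ * K + - f * 1ℤ                               ≡⟨ collect K f ⟩
    K - f                                           ∎
    where
    split : ∀ f a d → a - f * d ≡ 1ℤ * a + - f * (1ℤ * d)
    split = solve-∀
    collect : ∀ K f → 1ℤ * K + - f * 1ℤ ≡ K - f
    collect = solve-∀

  count-factorised : Fin n → + n * C ≡ (K - f) * ((K - f) - (e - f))
  count-factorised x = begin
    + n * C
      ≡⟨ isolate K (K - C) (Ac - C) (+ n * C) ⟩
    K * K - (K - C) - (Ac - C) * K - (K * K - ((K - C) + (Ac - C) * K + + n * C))
      ≡⟨ cong (_-_ (K * K - (K - C) - (Ac - C) * K)) (ℤ.i≡j⇒i-j≡0 (count-identity {Ac = Ac} rows A²≡ x)) ⟩
    K * K - (K - C) - (Ac - C) * K - 0ℤ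
      ≡⟨ cong₂ (λ s t → K * K - s - t * K - 0ℤ) ef≡ e+f≡ ⟩
    K * K - - (e * f) - (e + f) * K - 0ℤ
      ≡⟨ factorise K e f ⟩
    (K - f) * ((K - f) - (e - f)) ∎
    where
    isolate : ∀ K s t m → m ≡ K * K - s - t * K - (K * K - (s + t * K + m))
    isolate = solve-∀
    factorise : ∀ K e f → K * K - - (e * f) - (e + f) * K - 0ℤ ≡ (K - f) * ((K - f) - (e - f))
    factorise = solve-∀

  multiplicity-integral : Fin n → (∀ x → A x x ≡ 0ℤ) → e - f ∣ˢ (+ n - 1ℤ) * f + K
  multiplicity-integral x₀ loopless =
    subst (e - f ∣ˢ_) (ℤ.neg-involutive _) (∣m⇒∣-m (*-cancelˡ-∣ (+ n) {{nonZeroIndex x₀}} nθ∣n[-m]))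
    where
    Q : Mat n
    Q x y = + n * shifted x y - (K - f)
    diagonal : ∀ x → Q x x ≡ - ((+ n - 1ℤ) * f + K)
    diagonal x = trans (cong₂ (λ a d → + n * (a - f * d) - (K - f)) (loopless x) (δ-diag x)) (collect (+ n) f K)
      where
      collect : ∀ n f K → n * (0ℤ - f * 1ℤ) - (K - f) ≡ - ((n - 1ℤ) * f + K)
      collect = solve-∀
    nθ∣n[-m] : + n * (e - f) ∣ˢ + n * - ((+ n - 1ℤ) * f + K)
    nθ∣n[-m] = subst (+ n * (e - f) ∣ˢ_) (trans (sum-cong-≗ diagonal) (∑-const n _))
      (trace-divisible (+ n * (e - f)) Q
        (quasiIdempotent-projection shifted square-shifted rows-shifted columns-shifted (count-factorised x₀)))

-- The adjacency matrix of a strongly regular graph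

𝟙-∧ : ∀ a b → 𝟙 a * 𝟙 b ≡ 𝟙 (a ∧ b)
𝟙-∧ true  b = ℤ.*-identityˡ (𝟙 b)
𝟙-∧ false b = refl

card-tabulate : ∀ {m n} (p : Fin m → Bool) (g : Fin n → Fin m) →
                + length (filterᵇ p (tabulate g)) ≡ ∑[ i < n ] 𝟙 (p (g i))
card-tabulate {n = zero}  p g = refl
card-tabulate {n = suc n} p g with p (g zero) | card-tabulate p (λ i → g (suc i))
... | true  | ih = cong (_+_ 1ℤ) ih
... | false | ih = trans ih (sym (ℤ.+-identityˡ _))

card≡∑ : ∀ {n} (p : Fin n → Bool) → + card p ≡ ∑[ i < n ] 𝟙 (p i)
card≡∑ p = card-tabulate p (λ i → i)

adjacency : ∀ {n} → Graph n → Mat n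
adjacency G x y = 𝟙 (adj G x y)

square-adjacency : ∀ {n} (G : Graph n) x z → square (adjacency G) x z ≡ + commonNeighbours G x z
square-adjacency G x z =
  trans (sum-cong-≗ (λ y → 𝟙-∧ (adj G x y) (adj G y z))) (sym (card≡∑ (λ y → adj G x y ∧ adj G y z)))

module _ {n} {G : Graph n} {k a c : ℕ} (srg : IsSRG G k a c) where
  open IsSRG srg

  private
    A : Mat n
    A = adjacency G

  rows-adjacency : RowSums (+ k) A
  rows-adjacency x = trans (sym (card≡∑ (adj G x))) (cong +_ (regular x))

  columns-adjacency : ColumnSums (+ k) A
  columns-adjacency y = trans (sum-cong-≗ (λ x → cong 𝟙 (symmetric G x y))) (rows-adjacency y)

  adjacency-diagonal : ∀ x → A x x ≡ 0ℤ
  adjacency-diagonal x = cong 𝟙 (loopless G x)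

  srgEquation-adjacency : SRGEquation (+ k) (+ a) (+ c) A
  -- Splitting on x ≟ z also evaluates δ x z in the goal.
  srgEquation-adjacency x z with x ≟ z
  ... | yes refl = begin
    square A x x
      ≡⟨ sum-cong-≗ (λ y → trans (𝟙-∧ (adj G x y) (adj G y x))
                                 (cong 𝟙 (trans (cong (adj G x y ∧_) (symmetric G y x)) (∧-idem (adj G x y))))) ⟩
    sum (A x)
      ≡⟨ rows-adjacency x ⟩
    + k
      ≡⟨ collect (+ k) (+ a) (+ c) ⟩
    (+ k - + c) * 1ℤ + (+ a - + c) * 0ℤ + + c
      ≡⟨ cong (λ t → (+ k - + c) * 1ℤ + (+ a - + c) * t + + c) (sym (adjacency-diagonal x)) ⟩
    (+ k - + c) * 1ℤ + (+ a - + c) * A x x + + c ∎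
    where
    collect : ∀ k a c → k ≡ (k - c) * 1ℤ + (a - c) * 0ℤ + c
    collect = solve-∀
  ... | no x≢z = begin
    square A x z
      ≡⟨ square-adjacency G x z ⟩
    + commonNeighbours G x z
      ≡⟨ common (adj G x z) refl ⟩
    (+ k - + c) * 0ℤ + (+ a - + c) * A x z + + c ∎
    where
    common : ∀ b → adj G x z ≡ b → + commonNeighbours G x z ≡ (+ k - + c) * 0ℤ + (+ a - + c) * 𝟙 b + + c
    common true  adjacent     =
      trans (cong +_ (adjCommon x z (subst T (sym adjacent) tt))) (collect (+ k) (+ a) (+ c))
      where
      collect : ∀ k a c → a ≡ (k - c) * 0ℤ + (a - c) * 1ℤ + c
      collect = solve-∀
    common false nonadjacent =
      trans (cong +_ (nonAdjCommon x z x≢z (subst T nonadjacent))) (collect (+ k) (+ a) (+ c))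
      where
      collect : ∀ k a c → c ≡ (k - c) * 0ℤ + (a - c) * 0ℤ + c
      collect = solve-∀

-- Divisibility conditions on the eigenvalues

module Eigenvalues (N K Ac C e : ℤ) (root : e * e - (Ac - C) * e - (K - C) ≡ 0ℤ) where

  -- the other root of λ² − (Ac − C) λ − (K − C)
  f : ℤ
  f = Ac - C - e

  root-sum : Ac - C ≡ e + f
  root-sum = split (Ac - C) e
    where
    split : ∀ s e → s ≡ e + (s - e)
    split = solve-∀

  root-product : K - C ≡ - (e * f)
  root-product = begin
    K - C                                                   ≡⟨ expand K Ac C e ⟩
    - (e * f) - (e * e - (Ac - C) * e - (K - C))            ≡⟨ cong (_-_ (- (e * f))) root ⟩
    - (e * f) - 0ℤ                                          ≡⟨ ℤ.+-identityʳ (- (e * f)) ⟩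
    - (e * f)                                               ∎
    where
    expand : ∀ K Ac C e → K - C ≡ - (e * (Ac - C - e)) - (e * e - (Ac - C) * e - (K - C))
    expand = solve-∀

  module _ (count : N * C ≡ (K - f) * ((K - f) - (e - f))) where

    -- Modulo C (so K ≡ − e f and Ac ≡ e + f), D ≡ e (e + 1) f (f + 1) ≡ (K − e)(K − f) = N C.
    c∣D : C ∣ˢ e * (e + + 1) * (e - Ac) * (e - Ac - + 1)
    c∣D = divides q (begin
      e * (e + + 1) * (e - Ac) * (e - Ac - + 1)
        ≡⟨ expand N K Ac C e ⟩
      q * C - (N * C - (K - f) * ((K - f) - (e - f))) + (e * e - (Ac - C) * e - (K - C)) * (C - e * f + K - e - f)
        ≡⟨ cong₂ (λ s t → q * C - s + t * (C - e * f + K - e - f)) (ℤ.i≡j⇒i-j≡0 count) root ⟩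
      q * C - 0ℤ + 0ℤ * (C - e * f + K - e - f)
        ≡⟨ drop (q * C) (C - e * f + K - e - f) ⟩
      q * C ∎)
      where
      q : ℤ
      q = e * (e + + 1) * (C + + 2 * f + + 1) - C + f * (e + + 1) + e * (f + + 1) + N
      expand : ∀ N K Ac C e → let f = Ac - C - e in
        e * (e + + 1) * (e - Ac) * (e - Ac - + 1) ≡
        (e * (e + + 1) * (C + + 2 * f + + 1) - C + f * (e + + 1) + e * (f + + 1) + N) * C
          - (N * C - (K - f) * ((K - f) - (e - f))) + (e * e - (Ac - C) * e - (K - C)) * (C - e * f + K - e - f)
      expand = solve-∀
      drop : ∀ x y → x - 0ℤ + 0ℤ * y ≡ x
      drop = solve-∀

    -- Modulo e − f, where f ≡ e, F ≡ C ((N − 1) f + K) by the factorised count.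
    M∣F : e - f ∣ˢ (N - + 1) * f + K →
          C + + 2 * e - Ac ∣ˢ (e + + 1) * (e * e + + 2 * e - Ac) * (e * e + + 3 * e - Ac)
    M∣F θ∣m = subst (M ∣ˢ_) (sym F≡) (∣m∣n⇒∣m+n (∣n⇒∣m*n q ∣-refl) (∣n⇒∣m*n C M∣m))
      where
      M m q : ℤ
      M = C + + 2 * e - Ac
      m = (N - + 1) * f + K
      q = (e + + 1) * ((e + + 1) * ((e * e - C) + (e * e + e - C)) + M * (+ 1 - e * e)) + C * (N - + 1)
      M∣m : M ∣ˢ m
      M∣m = subst (_∣ˢ m) (same K Ac C e) θ∣m
        where
        same : ∀ K Ac C e → e - (Ac - C - e) ≡ C + + 2 * e - Ac
        same = solve-∀
      W : ℤ
      W = C + e * (K + (C - e * f) - e - f)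
      F≡ : (e + + 1) * (e * e + + 2 * e - Ac) * (e * e + + 3 * e - Ac) ≡ q * M + C * m
      F≡ = begin
        (e + + 1) * (e * e + + 2 * e - Ac) * (e * e + + 3 * e - Ac)
          ≡⟨ expand N K Ac C e ⟩
        q * M + C * m - e * (N * C - (K - f) * ((K - f) - (e - f))) + (e * e - (Ac - C) * e - (K - C)) * W
          ≡⟨ cong₂ (λ s t → q * M + C * m - e * s + t * W) (ℤ.i≡j⇒i-j≡0 count) root ⟩
        q * M + C * m - e * 0ℤ + 0ℤ * W
          ≡⟨ drop (q * M + C * m) e W ⟩
        q * M + C * m ∎
        where
        expand : ∀ N K Ac C e → let f = Ac - C - e ; M = C + + 2 * e - Ac in
          (e + + 1) * (e * e + + 2 * e - Ac) * (e * e + + 3 * e - Ac) ≡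
          ((e + + 1) * ((e + + 1) * ((e * e - C) + (e * e + e - C)) + M * (+ 1 - e * e)) + C * (N - + 1)) * M
            + C * ((N - + 1) * f + K) - e * (N * C - (K - f) * ((K - f) - (e - f)))
            + (e * e - (Ac - C) * e - (K - C)) * (C + e * (K + (C - e * f) - e - f))
        expand = solve-∀
        drop : ∀ x e w → x - e * 0ℤ + 0ℤ * w ≡ x
        drop = solve-∀

-- The empty graph is vacuously bipartite.
vertex : ∀ {n} {G : Graph n} {k a c} → IsSRG G k a c → Fin n
vertex {zero}  srg = ⊥-elim (IsSRG.nonBipartite srg ((λ ()) , (λ ())))
vertex {suc n} _   = zero

theorem3p1 : (n k a c : ℕ) (G : Graph n) → IsSRG G k a c →
    (e : ℤ) →
    e * e - (+ a - + c) * e - (+ k - + c) ≡ + 0 →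
    (+ a - + c) - e < e →
    (+ c ∣ e * (e + + 1) * (e - + a) * (e - + a - + 1))
    × (+ c + + 2 * e - + a ∣ (e + + 1) * (e * e + + 2 * e - + a) * (e * e + + 3 * e - + a))
theorem3p1 n k a c G srg e root _ = ∣⇒∣ᵤ (c∣D count) , ∣⇒∣ᵤ (M∣F count multiplicity)
  where
  open Eigenvalues (+ n) (+ k) (+ a) (+ c) e root
  open SRGMatrix {Ac = + a} {C = + c} (adjacency G) (rows-adjacency srg) (columns-adjacency srg)
                 (srgEquation-adjacency srg) {e} {f} root-sum root-product
  count : + n * + c ≡ (+ k - f) * ((+ k - f) - (e - f))
  count = count-factorised (vertex srg)
  multiplicity : e - f ∣ˢ (+ n - + 1) * f + + k
  multiplicity = multiplicity-integral (vertex srg) (adjacency-diagonal srg)
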